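{- Let $p$ be a prime. If an $(n,2,p,\lambda)$-strong external difference family exists (in some additive abelian group of order $n$), then $\lambda=1$.
   Context: For disjoint subsets $A,B$ of an additive abelian group $G$, let $\mathcal{D}(A,B)$ denote the multiset $\{x-y : x\in A,\ y\in B\}$. An $(n,m,k,\lambda)$-strong external difference family (SEDF) in an additive abelian group $G$ of order $n$ is a set of $m\geq 2$ pairwise disjoint $k$-subsets $A_1,\dots,A_m$ of $G$ such that for every $i$, $1\le i\le m$, the multiset union $\bigcup_{j\neq i}\mathcal{D}(A_i,A_j)$ equals $\lambda(G\setminus\{0\})$, i.e. contains every nonzero element of $G$ exactly $\lambda$ times. -}

module Defs where

open import Data.Nat using (ℕ; _≥_)
open import Data.Bool using (Bool; true; false; _∧_; if_then_else_)
open import Data.Fin using (Fin; _≟_)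
open import Data.Fin.Subset using (Subset; ∣_∣)
open import Data.Vec using (lookup)
open import Data.List using (List; length; filterᵇ; cartesianProduct; allFin; map)
open import Data.Nat.ListAction using (sum)
open import Data.Product using (_×_; _,_)
open import Data.Empty using (⊥)
open import Relation.Nullary using (¬_)
open import Relation.Nullary.Decidable using (isYes)
open import Relation.Binary.PropositionalEquality using (_≡_; _≢_)
open import Algebra.Core using (Op₁; Op₂)
open import Algebra.Structures using (IsAbelianGroup)

-- An additive abelian group of order n, presented (up to isomorphism)
-- as an abelian group structure on the n-element set Fin n.
record AbelianGroupOn (n : ℕ) : Set where
  field
    _+_ : Op₂ (Fin n)
    0#  : Fin n
    -_  : Op₁ (Fin n)
    isAbelianGroup : IsAbelianGroup _≡_ _+_ 0# -_

  _-_ : Op₂ (Fin n)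
  x - y = x + (- y)

  -- number of pairs (x , y) ∈ A × B with x - y ≡ g,
  -- i.e. the multiplicity of g in the multiset D(A,B)
  diffCount : Subset n → Subset n → Fin n → ℕ
  diffCount A B g =
    length (filterᵇ (λ { (x , y) → lookup A x ∧ (lookup B y ∧ isYes ((x - y) ≟ g)) })
                    (cartesianProduct (allFin n) (allFin n)))

  -- multiplicity of g in the multiset union ⋃_{j ≠ i} D(A_i, A_j)
  extCount : {m : ℕ} → (Fin m → Subset n) → Fin m → Fin n → ℕ
  extCount {m} A i g =
    sum (map (λ j → if isYes (i ≟ j) then 0 else diffCount (A i) (A j) g) (allFin m))

record IsSEDF {n : ℕ} (G : AbelianGroupOn n) (m k lam : ℕ) (A : Fin m → Subset n) : Set where
  open AbelianGroupOn G
  field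
    m≥2      : m ≥ 2
    disjoint : ∀ i j → i ≢ j → ∀ x → lookup (A i) x ≡ true → lookup (A j) x ≡ true → ⊥
    size     : ∀ i → ∣ A i ∣ ≡ k
    external : ∀ i (g : Fin n) → g ≢ 0# → extCount A i g ≡ lam

module Submission where

-- Let A₀, A₁ be the two blocks of an (n,2,k,λ)-SEDF.  Every
-- nonzero g occurs exactly λ times as a difference x - y with x ∈ A₀,
-- y ∈ A₁, and 0 never occurs because the blocks are disjoint; since each
-- of the k·k pairs yields exactly one difference, k·k = λ·(n - 1).
-- Disjointness also gives 2k ≤ n.  For k = p prime, write n = d + 1, so
-- p·p = d·λ with p < d; then λ < p, so p divides d, say d = q·p, whence
-- p = q·λ and irreducibility of p forces λ = 1.

open import Defs
open import Data.Nat using (nonTrivial⇒n>1; NonZero; ℕ; zero; suc; _+_; _*_; _≤_; _<_; z≤n; s≤s)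
open import Data.Nat.Properties hiding (_≟_)
open import Data.Nat.Divisibility using (_∣_; divides; ∣⇒≤)
open import Data.Nat.Primality using (Prime; euclidsLemma; prime⇒irreducible; prime⇒nonZero; prime⇒nonTrivial)
open import Data.Nat.ListAction using (sum)
open import Data.Nat.ListAction.Properties using (sum-++)
open import Data.Fin using (Fin; zero; suc; _≟_)
open import Data.Fin.Subset using (Subset; ∣_∣)
open import Data.Vec using (lookup; []; _∷_)
open import Data.List using (List; []; _∷_; length; filterᵇ; cartesianProduct; allFin; map; _++_)
open import Data.List.Properties using (map-tabulate; map-++)
open import Data.Bool using (Bool; true; false; _∧_)
open import Data.Product using (_×_; _,_; proj₁; proj₂)
open import Data.Sum using (_⊎_; inj₁; inj₂)
open import Data.Empty using (⊥; ⊥-elim)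
open import Relation.Nullary using (yes; no)
open import Relation.Nullary.Decidable using (isYes)
open import Relation.Binary.PropositionalEquality
open import Algebra.Structures using (IsAbelianGroup)
open import Function using (_∘_)
open import Algebra.Properties.CommutativeSemigroup +-commutativeSemigroup
  using () renaming (interchange to +-interchange)

𝟙 : Bool → ℕ
𝟙 true  = 1
𝟙 false = 0

sumOver : {A : Set} → (A → ℕ) → List A → ℕ
sumOver f xs = sum (map f xs)

module _ {A : Set} where

  sumOver-cong : {f g : A → ℕ} → (∀ x → f x ≡ g x) → ∀ xs → sumOver f xs ≡ sumOver g xs
  sumOver-cong f≗g []       = refl
  sumOver-cong f≗g (x ∷ xs) = cong₂ _+_ (f≗g x) (sumOver-cong f≗g xs)

  sumOver-zero : ∀ (xs : List A) → sumOver (λ _ → 0) xs ≡ 0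
  sumOver-zero []       = refl
  sumOver-zero (_ ∷ xs) = sumOver-zero xs

  sumOver-+ : (f g : A → ℕ) → ∀ xs → sumOver (λ x → f x + g x) xs ≡ sumOver f xs + sumOver g xs
  sumOver-+ f g []       = refl
  sumOver-+ f g (x ∷ xs) =
    trans (cong (f x + g x +_) (sumOver-+ f g xs)) (+-interchange (f x) (g x) _ _)

  sumOver-*ˡ : (c : ℕ) (f : A → ℕ) → ∀ xs → sumOver (λ x → c * f x) xs ≡ c * sumOver f xs
  sumOver-*ˡ c f []       = sym (*-zeroʳ c)
  sumOver-*ˡ c f (x ∷ xs) =
    trans (cong (c * f x +_) (sumOver-*ˡ c f xs)) (sym (*-distribˡ-+ c (f x) _))

  sumOver-*ʳ : (c : ℕ) (f : A → ℕ) → ∀ xs → sumOver (λ x → f x * c) xs ≡ sumOver f xs * c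
  sumOver-*ʳ c f []       = refl
  sumOver-*ʳ c f (x ∷ xs) =
    trans (cong (f x * c +_) (sumOver-*ʳ c f xs)) (sym (*-distribʳ-+ c (f x) _))

  sumOver-++ : (f : A → ℕ) (xs ys : List A) → sumOver f (xs ++ ys) ≡ sumOver f xs + sumOver f ys
  sumOver-++ f xs ys = trans (cong sum (map-++ f xs ys)) (sum-++ (map f xs) (map f ys))

  length-filterᵇ : (P : A → Bool) (xs : List A) → length (filterᵇ P xs) ≡ sumOver (𝟙 ∘ P) xs
  length-filterᵇ P []       = refl
  length-filterᵇ P (x ∷ xs) with P x
  ... | true  = cong suc (length-filterᵇ P xs)
  ... | false = length-filterᵇ P xs

sumOver-map : {A B : Set} (f : B → ℕ) (g : A → B) (xs : List A) → sumOver f (map g xs) ≡ sumOver (f ∘ g) xs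
sumOver-map f g []       = refl
sumOver-map f g (x ∷ xs) = cong (f (g x) +_) (sumOver-map f g xs)

module _ {A B : Set} where

  sumOver-comm : (f : A → B → ℕ) (xs : List A) (ys : List B) →
    sumOver (λ x → sumOver (f x) ys) xs ≡ sumOver (λ y → sumOver (λ x → f x y) xs) ys
  sumOver-comm f []       ys = sym (sumOver-zero ys)
  sumOver-comm f (x ∷ xs) ys =
    trans (cong (sumOver (f x) ys +_) (sumOver-comm f xs ys))
          (sym (sumOver-+ (f x) (λ y → sumOver (λ x → f x y) xs) ys))

  sumOver-cartesian : (f : A × B → ℕ) (xs : List A) (ys : List B) →
    sumOver f (cartesianProduct xs ys) ≡ sumOver (λ x → sumOver (λ y → f (x , y)) ys) xs
  sumOver-cartesian f []       ys = refl
  sumOver-cartesian f (x ∷ xs) ys =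
    trans (sumOver-++ f (map (x ,_) ys) (cartesianProduct xs ys))
          (cong₂ _+_ (sumOver-map f (x ,_) ys) (sumOver-cartesian f xs ys))

ΣFin : (n : ℕ) → (Fin n → ℕ) → ℕ
ΣFin n f = sumOver f (allFin n)

ΣFin-suc : ∀ n (f : Fin (suc n) → ℕ) → ΣFin (suc n) f ≡ f zero + ΣFin n (f ∘ suc)
ΣFin-suc n f = cong (λ xs → f zero + sum xs)
  (trans (map-tabulate suc f) (sym (map-tabulate (λ x → x) (f ∘ suc))))

ΣFin-const : ∀ n c → ΣFin n (λ _ → c) ≡ n * c
ΣFin-const zero    c = refl
ΣFin-const (suc n) c = trans (ΣFin-suc n _) (cong (c +_) (ΣFin-const n c))

ΣFin-delta : ∀ n (a : Fin n) → ΣFin n (λ g → 𝟙 (isYes (a ≟ g))) ≡ 1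
ΣFin-delta (suc n) zero    = trans (ΣFin-suc n (λ g → 𝟙 (isYes (zero ≟ g)))) (cong suc (sumOver-zero (allFin n)))
ΣFin-delta (suc n) (suc a) =
  trans (ΣFin-suc n (λ g → 𝟙 (isYes (suc a ≟ g)))) (trans (sumOver-cong shift (allFin n)) (ΣFin-delta n a))
  where
  shift : ∀ g → 𝟙 (isYes (suc a ≟ suc g)) ≡ 𝟙 (isYes (a ≟ g))
  shift g with a ≟ g
  ... | yes _ = refl
  ... | no  _ = refl

-- A function vanishing at z and equal to λ elsewhere has sum (n - 1)·λ,
-- stated without subtraction.
ΣFin-punctured : ∀ n (z : Fin n) (f : Fin n → ℕ) lam →
  f z ≡ 0 → (∀ g → g ≢ z → f g ≡ lam) → ΣFin n f + lam ≡ n * lam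
ΣFin-punctured n z f lam fz≡0 f≡lam = begin
  ΣFin n f + lam
    ≡⟨ cong (ΣFin n f +_) (sym λ-at-z) ⟩
  ΣFin n f + ΣFin n (λ g → lam * 𝟙 (isYes (z ≟ g)))
    ≡⟨ sym (sumOver-+ f _ (allFin n)) ⟩
  ΣFin n (λ g → f g + lam * 𝟙 (isYes (z ≟ g)))
    ≡⟨ sumOver-cong filled (allFin n) ⟩
  ΣFin n (λ _ → lam)
    ≡⟨ ΣFin-const n lam ⟩
  n * lam ∎
  where
  open ≡-Reasoning
  λ-at-z : ΣFin n (λ g → lam * 𝟙 (isYes (z ≟ g))) ≡ lam
  λ-at-z = trans (sumOver-*ˡ lam _ (allFin n))
                 (trans (cong (lam *_) (ΣFin-delta n z)) (*-identityʳ lam))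
  filled : ∀ g → f g + lam * 𝟙 (isYes (z ≟ g)) ≡ lam
  filled g with z ≟ g
  ... | yes refl = trans (cong (_+ lam * 1) fz≡0) (*-identityʳ lam)
  ... | no  z≢g  = trans (cong₂ _+_ (f≡lam g (z≢g ∘ sym)) (*-zeroʳ lam)) (+-identityʳ lam)

∣∣-as-sum : ∀ {n} (A : Subset n) → ∣ A ∣ ≡ ΣFin n (𝟙 ∘ lookup A)
∣∣-as-sum []                = refl
∣∣-as-sum {suc n} (true ∷ A)  = trans (cong suc (∣∣-as-sum A)) (sym (ΣFin-suc n (𝟙 ∘ lookup (true ∷ A))))
∣∣-as-sum {suc n} (false ∷ A) = trans (∣∣-as-sum A) (sym (ΣFin-suc n (𝟙 ∘ lookup (false ∷ A))))

disjoint-count-≤ : ∀ n (a b : Fin n → Bool) → (∀ x → a x ≡ true → b x ≡ true → ⊥) →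
  ΣFin n (𝟙 ∘ a) + ΣFin n (𝟙 ∘ b) ≤ n
disjoint-count-≤ zero    a b a∩b≡∅ = z≤n
disjoint-count-≤ (suc n) a b a∩b≡∅
  rewrite ΣFin-suc n (𝟙 ∘ a) | ΣFin-suc n (𝟙 ∘ b)
  with a zero | b zero | a∩b≡∅ zero | disjoint-count-≤ n (a ∘ suc) (b ∘ suc) (a∩b≡∅ ∘ suc)
... | true  | true  | not-both | _  = ⊥-elim (not-both refl refl)
... | true  | false | _        | ih = s≤s ih
... | false | true  | _        | ih = subst (_≤ suc n) (sym (+-suc _ _)) (s≤s ih)
... | false | false | _        | ih = m≤n⇒m≤1+n ih

module DifferenceCounts {n : ℕ} (G : AbelianGroupOn n) where
  open AbelianGroupOn G renaming (_+_ to _⊕_)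
  open IsAbelianGroup isAbelianGroup using (assoc; identityˡ; identityʳ; inverseˡ)

  x-y≡0⇒x≡y : ∀ x y → x - y ≡ 0# → x ≡ y
  x-y≡0⇒x≡y x y x-y≡0 = begin
    x               ≡⟨ sym (identityʳ x) ⟩
    x ⊕ 0#          ≡⟨ cong (x ⊕_) (sym (inverseˡ y)) ⟩
    x ⊕ ((- y) ⊕ y) ≡⟨ sym (assoc x (- y) y) ⟩
    (x - y) ⊕ y     ≡⟨ cong (_⊕ y) x-y≡0 ⟩
    0# ⊕ y          ≡⟨ identityˡ y ⟩
    y               ∎
    where open ≡-Reasoning

  hit : Subset n → Subset n → Fin n → Fin n × Fin n → ℕ
  hit A B g (x , y) = 𝟙 (lookup A x ∧ (lookup B y ∧ isYes ((x - y) ≟ g)))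

  pairs : List (Fin n × Fin n)
  pairs = cartesianProduct (allFin n) (allFin n)

  diffCount-as-sum : ∀ A B g → diffCount A B g ≡ sumOver (hit A B g) pairs
  diffCount-as-sum A B g = length-filterᵇ _ pairs

  diffCount-zero : ∀ (A B : Subset n) → (∀ x → lookup A x ≡ true → lookup B x ≡ true → ⊥) →
    diffCount A B 0# ≡ 0
  diffCount-zero A B A∩B≡∅ =
    trans (diffCount-as-sum A B 0#) (trans (sumOver-cong no-hit pairs) (sumOver-zero pairs))
    where
    no-hit : ∀ e → hit A B 0# e ≡ 0
    no-hit (x , y) with lookup A x in x∈A | lookup B y in y∈B | (x - y) ≟ 0#
    ... | true  | true  | yes x-y≡0 =
      ⊥-elim (A∩B≡∅ x x∈A (subst (λ z → lookup B z ≡ true) (sym (x-y≡0⇒x≡y x y x-y≡0)) y∈B))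
    ... | true  | true  | no _ = refl
    ... | true  | false | _    = refl
    ... | false | _     | _    = refl

  -- Every pair has exactly one difference, so all multiplicities add up to |A|·|B|.
  diffCount-total : ∀ (A B : Subset n) → ΣFin n (diffCount A B) ≡ ∣ A ∣ * ∣ B ∣
  diffCount-total A B = begin
    ΣFin n (diffCount A B)
      ≡⟨ sumOver-cong (diffCount-as-sum A B) (allFin n) ⟩
    ΣFin n (λ g → sumOver (hit A B g) pairs)
      ≡⟨ sumOver-comm (λ g → hit A B g) (allFin n) pairs ⟩
    sumOver (λ e → ΣFin n (λ g → hit A B g e)) pairs
      ≡⟨ sumOver-cong one-difference pairs ⟩
    sumOver (λ { (x , y) → 𝟙 (lookup A x) * 𝟙 (lookup B y) }) pairs
      ≡⟨ sumOver-cartesian _ (allFin n) (allFin n) ⟩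
    ΣFin n (λ x → ΣFin n (λ y → 𝟙 (lookup A x) * 𝟙 (lookup B y)))
      ≡⟨ sumOver-cong (λ x → sumOver-*ˡ (𝟙 (lookup A x)) _ (allFin n)) (allFin n) ⟩
    ΣFin n (λ x → 𝟙 (lookup A x) * ΣFin n (𝟙 ∘ lookup B))
      ≡⟨ sumOver-*ʳ _ _ (allFin n) ⟩
    ΣFin n (𝟙 ∘ lookup A) * ΣFin n (𝟙 ∘ lookup B)
      ≡⟨ sym (cong₂ _*_ (∣∣-as-sum A) (∣∣-as-sum B)) ⟩
    ∣ A ∣ * ∣ B ∣ ∎
    where
    open ≡-Reasoning
    one-difference : ∀ e → ΣFin n (λ g → hit A B g e) ≡ 𝟙 (lookup A (proj₁ e)) * 𝟙 (lookup B (proj₂ e))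
    one-difference (x , y) with lookup A x | lookup B y
    ... | true  | true  = ΣFin-delta n (x - y)
    ... | true  | false = sumOver-zero (allFin n)
    ... | false | _     = sumOver-zero (allFin n)

module TwoBlockSEDF {n k lam : ℕ} {G : AbelianGroupOn n} {A : Fin 2 → Subset n}
                    (sedf : IsSEDF G 2 k lam A) where
  open AbelianGroupOn G using (diffCount; 0#)
  open DifferenceCounts G
  open IsSEDF sedf

  blocks-disjoint : ∀ x → lookup (A zero) x ≡ true → lookup (A (suc zero)) x ≡ true → ⊥
  blocks-disjoint = disjoint zero (suc zero) (λ ())

  -- With two blocks, the external count for A₀ is the single difference count D(A₀, A₁).
  multiplicity : ∀ g → g ≢ 0# → diffCount (A zero) (A (suc zero)) g ≡ lam
  multiplicity g g≢0 = trans (sym (+-identityʳ _)) (external zero g g≢0)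

  count-identity : k * k + lam ≡ n * lam
  count-identity = begin
    k * k + lam
      ≡⟨ cong (_+ lam) (sym (cong₂ _*_ (size zero) (size (suc zero)))) ⟩
    ∣ A zero ∣ * ∣ A (suc zero) ∣ + lam
      ≡⟨ cong (_+ lam) (sym (diffCount-total (A zero) (A (suc zero)))) ⟩
    ΣFin n (diffCount (A zero) (A (suc zero))) + lam
      ≡⟨ ΣFin-punctured n 0# (diffCount (A zero) (A (suc zero))) lam
           (diffCount-zero (A zero) (A (suc zero)) blocks-disjoint) multiplicity ⟩
    n * lam ∎
    where open ≡-Reasoning

  size-bound : k + k ≤ n
  size-bound = subst₂ (λ a b → a + b ≤ n)
    (trans (sym (∣∣-as-sum (A zero))) (size zero))
    (trans (sym (∣∣-as-sum (A (suc zero)))) (size (suc zero)))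
    (disjoint-count-≤ n (lookup (A zero)) (lookup (A (suc zero))) blocks-disjoint)

prime>1 : ∀ {p} → Prime p → 1 < p
prime>1 {p} pp = nonTrivial⇒n>1 p {{prime⇒nonTrivial pp}}

-- If p² = d·λ with p prime and d > p, then λ = 1: λ < p, so p ∤ λ and
-- p ∣ d; writing d = q·p gives p = q·λ, and p is irreducible.
prime-square-factor : ∀ {p d lam} → Prime p → p * p ≡ d * lam → p < d → lam ≡ 1
prime-square-factor {p} {d} {lam} pp p²≡d·λ p<d = exclude-λ≡p (prime⇒irreducible pp λ∣p)
  where
  instance _ = prime⇒nonZero pp

  λ<p : lam < p
  λ<p = ≰⇒> λ p≤λ → <-irrefl p²≡d·λ (<-≤-trans (*-monoˡ-< p p<d) (*-monoʳ-≤ d p≤λ))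

  λ≢0 : NonZero lam
  λ≢0 = m*n≢0⇒n≢0 d {{subst NonZero p²≡d·λ (m*n≢0 p p)}}

  p∣d : p ∣ d
  p∣d with euclidsLemma d lam pp (divides p (sym p²≡d·λ))
  ... | inj₁ p∣d = p∣d
  ... | inj₂ p∣λ = ⊥-elim (<⇒≱ λ<p (∣⇒≤ {{λ≢0}} p∣λ))

  λ∣p : lam ∣ p
  λ∣p with p∣d
  ... | divides q d≡q·p = divides q (*-cancelʳ-≡ p (q * lam) p (begin
    p * p         ≡⟨ p²≡d·λ ⟩
    d * lam       ≡⟨ cong (_* lam) d≡q·p ⟩
    q * p * lam   ≡⟨ *-assoc q p lam ⟩
    q * (p * lam) ≡⟨ cong (q *_) (*-comm p lam) ⟩
    q * (lam * p) ≡⟨ sym (*-assoc q lam p) ⟩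
    q * lam * p   ∎))
    where open ≡-Reasoning

  exclude-λ≡p : lam ≡ 1 ⊎ lam ≡ p → lam ≡ 1
  exclude-λ≡p (inj₁ λ≡1) = λ≡1
  exclude-λ≡p (inj₂ λ≡p) = ⊥-elim (<-irrefl λ≡p λ<p)

prime-block-constraints : ∀ {p n lam} → Prime p → p * p + lam ≡ n * lam → p + p ≤ n → lam ≡ 1
prime-block-constraints {p} {zero} pp _ 2p≤0 =
  ⊥-elim (n≮0 (<-≤-trans (prime>1 pp) (≤-trans (m≤m+n p p) 2p≤0)))
prime-block-constraints {p} {suc d} {lam} pp count 2p≤1+d =
  prime-square-factor pp p²≡d·λ p<d
  where
  p²≡d·λ : p * p ≡ d * lam
  p²≡d·λ = +-cancelʳ-≡ lam (p * p) (d * lam) (trans count (+-comm lam (d * lam)))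
  p<d : p < d
  p<d = ≤-pred (≤-trans (+-monoˡ-≤ p (prime>1 pp)) 2p≤1+d)

lemma3p4 : (p n lam : ℕ) → Prime p → (G : AbelianGroupOn n) → (A : Fin 2 → Subset n)
           → IsSEDF G 2 p lam A → lam ≡ 1
lemma3p4 p n lam pp G A sedf =
  prime-block-constraints pp count-identity size-bound
  where open TwoBlockSEDF sedf
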